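{- Suppose there are constants $C,a,C_0>0$ such that the following two statements hold for every finite simple graph $G$ and every integer $m\ge 1$: (1) every $2$-modular witness $S\subseteq V(G)$ with $|S|\ge C_0 m$ contains a $4$-modular witness $S'\subseteq S$ with exactly $m$ vertices; (2) for every power of two $q=2^j$ with $q\ge 4$, every $q$-modular witness $S\subseteq V(G)$ with $|S|\ge C q^a m$ contains a $2q$-modular witness $S'\subseteq S$ with exactly $m$ vertices. Then there exists a constant $A$ such that $M(2^r,2^r)\le 2^{A(r+1)^2}$ for all $r\ge 1$. Consequently $F(n)/\log n\to\infty$ as $n\to\infty$.
   Context: All graphs are finite, simple, undirected. For $S\subseteq V(G)$, $G[S]$ is the induced subgraph and $\deg_S(v)$ is the degree of $v$ in $G[S]$. For an integer $q\ge1$, a set $U\subseteq V(G)$ is a $q$-modular witness ($q$-modular) if $\deg_U(u)\equiv\deg_U(v)\pmod q$ for all $u,v\in U$. $f(G)=\max\{|S|: G[S]\text{ is regular}\}$ and $F(n)=\min_{|V(G)|=n} f(G)$. For a power of two $q$ and integer $m\ge1$, $M(q,m)$ is the least $N$ such that every graph with at least $N$ vertices contains a $q$-modular witness of exactly $m$ vertices. -}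

module Defs where

open import Data.Nat using (ℕ; zero; suc; _^_; _%_; NonZero)
open import Data.Bool using (Bool; true; false)
open import Data.Fin using (Fin)
open import Data.Fin.Subset using (Subset; _∈_; _∩_; ∣_∣)
open import Data.Vec using (tabulate)
open import Data.Product using (∃)
open import Relation.Binary.PropositionalEquality using (_≡_)

record Graph (n : ℕ) : Set where
  field
    adj   : Fin n → Fin n → Bool
    sym   : ∀ u v → adj u v ≡ adj v u
    irrfl : ∀ v → adj v v ≡ false
open Graph public

N : ∀ {n} → Graph n → Fin n → Subset n
N G v = tabulate (adj G v)

deg : ∀ {n} → Graph n → Subset n → Fin n → ℕ
deg G S v = ∣ S ∩ N G v ∣

Modular : ∀ {n} (q : ℕ) .{{_ : NonZero q}} → Graph n → Subset n → Set
Modular q G U = ∀ u v → u ∈ U → v ∈ U → deg G U u % q ≡ deg G U v % q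

Regular : ∀ {n} → Graph n → Subset n → Set
Regular G S = ∃ λ d → ∀ v → v ∈ S → deg G S v ≡ d

-- By Gallai's theorem the vertices of every graph split into two parts, each inducing a subgraph
-- with all degrees even.  It is proved by induction on the vertex set: delete a vertex v of odd
-- degree after complementing the graph inside the neighbourhood of v, split the rest, and put v back
-- into the part in which it has an even number of neighbours.  Hence every graph on n vertices has
-- a 2-modular set of at least n/2 vertices.  Hypothesis (1) followed by hypothesis (2) for
-- q = 4, 8, …, 2^r refines a 2-modular set of b·m vertices into a 2^(r+1)-modular, hence 2^r-modular,
-- set of exactly m vertices, where b = C₀ · ∏ C (2^j)^a ≤ 2^(c (r+1)^2) with c = C₀ + C + a; taking
-- m = 2^r bounds M(2^r, 2^r).  A 2^r-modular set of 2^r vertices induces a regular subgraph, since all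
-- its degrees are below 2^r.  Choosing r maximal with 2^(A (r+1)^2) ≤ n gives
-- n^K < 2^(K A (r+2)^2) ≤ 2^(2^r) once r is large, because 2^r outgrows every quadratic in r.
module Submission where

open import Defs
open import Algebra.Bundles using (CommutativeRing)
open import Data.Bool using (Bool; true; false; not; _∧_; _xor_; if_then_else_)
open import Data.Bool.Properties
  using (∧-distribˡ-xor; ∧-distribʳ-xor; ∧-comm; ∧-zeroʳ; ∧-identityʳ; xor-assoc; xor-comm; xor-identityʳ;
         xor-same; xor-∧-commutativeRing; ¬-not)
  renaming (_≟_ to _≟ᵇ_)
open import Algebra.Properties.CommutativeSemigroup (CommutativeRing.+-commutativeSemigroup xor-∧-commutativeRing)
  using (interchange; xy∙z≈xz∙y)
open import Data.Nat using (ℕ; zero; suc; _+_; _*_; _^_; _≤_; _<_; _%_; z≤n; s≤s; NonZero; _≤?_)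
open import Data.Nat.Properties
  using (m^n≢0; m^n>0; suc-injective; ≤-refl; ≤-trans; ≤-reflexive; ≤-total; <-≤-trans; ≤-<-trans; <⇒≤; <⇒≱; ≰⇒>;
         n≤1+n; m≤m+n; m≤n+m; +-suc; +-identityʳ; +-mono-≤; +-monoˡ-≤; +-monoʳ-≤; *-mono-≤; *-monoˡ-≤; *-monoʳ-≤;
         *-cancelˡ-≤; *-assoc; ^-monoʳ-≤; ^-monoˡ-≤; ^-distribˡ-+-*; ^-*-assoc; ≤ᵇ⇒≤; m≤n⇒∃[o]m+o≡n;
         module ≤-Reasoning)
open import Data.Nat.Divisibility using (_∣_; n∣m*n)
open import Data.Nat.DivMod using (%-distribˡ-+; m∣n⇒o%n%m≡o%m; m<n⇒m%n≡m)
open import Data.Nat.Tactic.RingSolver using (solve-∀)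
open import Data.Fin using (Fin; zero; suc)
open import Data.Fin.Properties using (_≟_; any?)
open import Data.Fin.Subset using (Subset; _⊆_; _∈_; _∉_; _∩_; ∣_∣)
open import Data.Fin.Subset.Properties using (⊆-trans; p⊂q⇒∣p∣<∣q∣; p∩q⊆p; x∈p∩q⁻; nonempty?)
open import Data.Vec using (tabulate; _∷_)
open import Data.Vec.Properties using (tabulate-cong; []=⇒lookup; lookup∘tabulate)
open import Data.Vec.Functional using (foldr)
open import Data.Product using (∃; _×_; _,_; proj₂)
open import Data.Sum using (inj₁; inj₂)
open import Data.Empty using (⊥-elim)
open import Function using (_∘_)
open import Relation.Nullary using (¬_; does; yes; no)
open import Relation.Nullary.Decidable using (dec-true; dec-false; _×-dec_)
open import Relation.Unary using (Decidable)
open import Relation.Binary.PropositionalEquality using (_≡_; refl; trans; cong; cong₂; subst; _≗_; module ≡-Reasoning)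
import Relation.Binary.PropositionalEquality as ≡

δ : ∀ {n} → Fin n → Fin n → Bool
δ u v = does (u ≟ v)

δ-refl : ∀ {n} (v : Fin n) → δ v v ≡ true
δ-refl v = dec-true (v ≟ v) refl

δ-sym : ∀ {n} (u v : Fin n) → δ u v ≡ δ v u
δ-sym u v with u ≟ v
... | yes refl = ≡.sym (δ-refl u)
... | no u≢v = ≡.sym (dec-false (v ≟ u) (u≢v ∘ ≡.sym))

δ⇒≡ : ∀ {n} {u v : Fin n} → δ u v ≡ true → u ≡ v
δ⇒≡ {u = u} {v} eq with u ≟ v
... | yes u≡v = u≡v

parity : ∀ {n} → (Fin n → Bool) → Bool
parity = foldr _xor_ false

parity-cong : ∀ {n} {f g : Fin n → Bool} → f ≗ g → parity f ≡ parity g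
parity-cong {zero} _ = refl
parity-cong {suc n} f≗g = cong₂ _xor_ (f≗g zero) (parity-cong (f≗g ∘ suc))

parity-xor : ∀ {n} (f g : Fin n → Bool) → parity (λ i → f i xor g i) ≡ parity f xor parity g
parity-xor {zero} f g = refl
parity-xor {suc n} f g =
  trans (cong ((f zero xor g zero) xor_) (parity-xor (f ∘ suc) (g ∘ suc)))
        (interchange (f zero) (g zero) (parity (f ∘ suc)) (parity (g ∘ suc)))

parity-∧ˡ : ∀ {n} b (f : Fin n → Bool) → parity (λ i → b ∧ f i) ≡ b ∧ parity f
parity-∧ˡ {zero} b f = ≡.sym (∧-zeroʳ b)
parity-∧ˡ {suc n} b f =
  trans (cong ((b ∧ f zero) xor_) (parity-∧ˡ b (f ∘ suc))) (≡.sym (∧-distribˡ-xor b (f zero) (parity (f ∘ suc))))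

parity-δ : ∀ {n} (u : Fin n) (f : Fin n → Bool) → parity (λ i → δ u i ∧ f i) ≡ f u
parity-δ zero f = trans (cong (f zero xor_) (parity-∧ˡ false (f ∘ suc))) (xor-identityʳ (f zero))
parity-δ (suc u) f = parity-δ u (f ∘ suc)

∧-not≡xor-∧ : ∀ x e → x ∧ not e ≡ x xor (e ∧ x)
∧-not≡xor-∧ false false = refl
∧-not≡xor-∧ false true = refl
∧-not≡xor-∧ true false = refl
∧-not≡xor-∧ true true = refl

parity-without : ∀ {n} (u : Fin n) (f : Fin n → Bool) → parity (λ i → f i ∧ not (δ u i)) ≡ parity f xor f u
parity-without u f = begin
  parity (λ i → f i ∧ not (δ u i))     ≡⟨ parity-cong (λ i → ∧-not≡xor-∧ (f i) (δ u i)) ⟩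
  parity (λ i → f i xor (δ u i ∧ f i)) ≡⟨ parity-xor f (λ i → δ u i ∧ f i) ⟩
  parity f xor parity (λ i → δ u i ∧ f i) ≡⟨ cong (parity f xor_) (parity-δ u f) ⟩
  parity f xor f u ∎
  where open ≡-Reasoning

oddDegree : ∀ {n} → Graph n → (Fin n → Bool) → Fin n → Bool
oddDegree G P u = parity (λ i → P i ∧ adj G u i)

oddDegree-xor : ∀ {n} (G : Graph n) (A B : Fin n → Bool) u →
  oddDegree G (λ i → A i xor B i) u ≡ oddDegree G A u xor oddDegree G B u
oddDegree-xor G A B u =
  trans (parity-cong (λ i → ∧-distribʳ-xor (adj G u i) (A i) (B i)))
        (parity-xor (λ i → A i ∧ adj G u i) (λ i → B i ∧ adj G u i))

oddDegree-δ : ∀ {n} (G : Graph n) v u → oddDegree G (δ v) u ≡ adj G u v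
oddDegree-δ G v u = parity-δ v (adj G u)

localComplement : ∀ {n} → Graph n → Fin n → Graph n
localComplement G v = record
  { adj   = λ x y → adj G x y xor ((adj G v x ∧ adj G v y) ∧ not (δ x y))
  ; sym   = λ x y → cong₂ _xor_ (Graph.sym G x y)
                      (cong₂ (λ b e → b ∧ not e) (∧-comm (adj G v x) (adj G v y)) (δ-sym x y))
  ; irrfl = λ x → trans (cong₂ (λ a e → a xor ((adj G v x ∧ adj G v x) ∧ not e)) (irrfl G x) (δ-refl x))
                        (∧-zeroʳ (adj G v x ∧ adj G v x))
  }

∧-rearrange : ∀ p a c e → p ∧ ((a ∧ c) ∧ e) ≡ a ∧ ((p ∧ c) ∧ e)
∧-rearrange false false c e = refl
∧-rearrange false true c e = refl
∧-rearrange true false c e = refl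
∧-rearrange true true c e = refl

∧-xor-self : ∀ a x → a ∧ (x xor a) ≡ a ∧ not x
∧-xor-self false x = refl
∧-xor-self true false = refl
∧-xor-self true true = refl

oddDegree-localComplement : ∀ {n} (G : Graph n) v (P : Fin n → Bool) u → P u ≡ true →
  oddDegree (localComplement G v) P u ≡ oddDegree G P u xor (adj G v u ∧ not (oddDegree G P v))
oddDegree-localComplement G v P u Pu = begin
  parity (λ i → P i ∧ (adj G u i xor ((a ∧ adj G v i) ∧ not (δ u i))))
    ≡⟨ parity-cong (λ i → trans (∧-distribˡ-xor (P i) _ _) (cong ((P i ∧ adj G u i) xor_) (∧-rearrange (P i) a _ _))) ⟩
  parity (λ i → (P i ∧ adj G u i) xor (a ∧ ((P i ∧ adj G v i) ∧ not (δ u i))))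
    ≡⟨ parity-xor (λ i → P i ∧ adj G u i) (λ i → a ∧ ((P i ∧ adj G v i) ∧ not (δ u i))) ⟩
  oddDegree G P u xor parity (λ i → a ∧ ((P i ∧ adj G v i) ∧ not (δ u i)))
    ≡⟨ cong (oddDegree G P u xor_) (parity-∧ˡ a (λ i → (P i ∧ adj G v i) ∧ not (δ u i))) ⟩
  oddDegree G P u xor (a ∧ parity (λ i → (P i ∧ adj G v i) ∧ not (δ u i)))
    ≡⟨ cong (λ x → oddDegree G P u xor (a ∧ x)) (parity-without u (λ i → P i ∧ adj G v i)) ⟩
  oddDegree G P u xor (a ∧ (oddDegree G P v xor (P u ∧ a)))
    ≡⟨ cong (λ b → oddDegree G P u xor (a ∧ (oddDegree G P v xor (b ∧ a)))) Pu ⟩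
  oddDegree G P u xor (a ∧ (oddDegree G P v xor a))
    ≡⟨ cong (oddDegree G P u xor_) (∧-xor-self a (oddDegree G P v)) ⟩
  oddDegree G P u xor (a ∧ not (oddDegree G P v)) ∎
  where
  open ≡-Reasoning
  a = adj G v u

record EvenPartition {n} (G : Graph n) (W : Fin n → Bool) : Set where
  field
    left right : Fin n → Bool
    splits     : ∀ i → W i ≡ left i xor right i
    disjoint   : ∀ i → left i ∧ right i ≡ false
    left-even  : ∀ u → left u ≡ true → oddDegree G left u ≡ false
    right-even : ∀ u → right u ≡ true → oddDegree G right u ≡ false

swapSides : ∀ {n} {G : Graph n} {W} → EvenPartition G W → EvenPartition G W
swapSides P = record
  { left       = right
  ; right      = left
  ; splits     = λ i → trans (splits i) (xor-comm (left i) (right i))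
  ; disjoint   = λ i → trans (∧-comm (right i) (left i)) (disjoint i)
  ; left-even  = right-even
  ; right-even = left-even
  }
  where open EvenPartition P

allEven : ∀ {n} (G : Graph n) (W : Fin n → Bool) → (∀ u → W u ≡ true → oddDegree G W u ≡ false) → EvenPartition G W
allEven G W even = record
  { left       = W
  ; right      = λ _ → false
  ; splits     = λ i → ≡.sym (xor-identityʳ (W i))
  ; disjoint   = λ i → ∧-zeroʳ (W i)
  ; left-even  = even
  ; right-even = λ _ ()
  }

xor-cancelʳ : ∀ x d → (x xor d) xor d ≡ x
xor-cancelʳ x d = trans (xor-assoc x d d) (trans (cong (x xor_) (xor-same d)) (xor-identityʳ x))

equal∧disjoint⇒false : ∀ {x y} → x xor y ≡ false → x ∧ y ≡ false → y ≡ false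
equal∧disjoint⇒false {false} {false} _ _ = refl
equal∧disjoint⇒false {true} {true} _ ()

δ-∧ : ∀ {n} (f : Fin n → Bool) v → f v ≡ false → ∀ i → δ v i ∧ f i ≡ false
δ-∧ f v fv i with δ v i in e
... | false = refl
... | true = subst (λ j → f j ≡ false) (δ⇒≡ e) fv

-- As W v ≡ true, the set W xor δ v is W with v deleted.
addVertex : ∀ {n} (G : Graph n) (W : Fin n → Bool) v → W v ≡ true →
  (P : EvenPartition (localComplement G v) (λ i → W i xor δ v i)) →
  oddDegree G (EvenPartition.left P) v ≡ false → oddDegree G (EvenPartition.right P) v ≡ true →
  EvenPartition G W
addVertex {n} G W v Wv P evenL oddR = record
  { left       = L⁺
  ; right      = R
  ; splits     = λ i → begin
      W i                          ≡⟨ ≡.sym (xor-cancelʳ (W i) (δ v i)) ⟩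
      (W i xor δ v i) xor δ v i    ≡⟨ cong (_xor δ v i) (splits i) ⟩
      (L i xor R i) xor δ v i      ≡⟨ xy∙z≈xz∙y (L i) (R i) (δ v i) ⟩
      L⁺ i xor R i                 ∎
  ; disjoint   = λ i → trans (∧-distribʳ-xor (R i) (L i) (δ v i)) (cong₂ _xor_ (disjoint i) (δ-∧ R v Rv i))
  ; left-even  = evenL⁺
  ; right-even = evenR
  }
  where
  open ≡-Reasoning
  open EvenPartition P renaming (left to L; right to R)
  L⁺ : Fin n → Bool
  L⁺ i = L i xor δ v i
  Rv : R v ≡ false
  Rv = equal∧disjoint⇒false (trans (≡.sym (splits v)) (cong₂ _xor_ Wv (δ-refl v))) (disjoint v)
  oddDegree-L⁺ : ∀ u → oddDegree G L⁺ u ≡ oddDegree G L u xor adj G u v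
  oddDegree-L⁺ u = trans (oddDegree-xor G L (δ v) u) (cong (oddDegree G L u xor_) (oddDegree-δ G v u))
  evenL⁺ : ∀ u → L u xor δ v u ≡ true → oddDegree G L⁺ u ≡ false
  evenL⁺ u h with L u in Lu
  ... | true = begin
    oddDegree G L⁺ u                                      ≡⟨ oddDegree-L⁺ u ⟩
    oddDegree G L u xor adj G u v                         ≡⟨ cong (oddDegree G L u xor_) (Graph.sym G u v) ⟩
    oddDegree G L u xor adj G v u                         ≡⟨ cong (oddDegree G L u xor_) (≡.sym (∧-identityʳ (adj G v u))) ⟩
    oddDegree G L u xor (adj G v u ∧ true)                ≡⟨ cong (λ x → oddDegree G L u xor (adj G v u ∧ not x)) (≡.sym evenL) ⟩
    oddDegree G L u xor (adj G v u ∧ not (oddDegree G L v)) ≡⟨ ≡.sym (oddDegree-localComplement G v L u Lu) ⟩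
    oddDegree (localComplement G v) L u                   ≡⟨ left-even u Lu ⟩
    false                                                 ∎
  ... | false with refl ← δ⇒≡ {u = v} {u} h = trans (oddDegree-L⁺ v) (cong₂ _xor_ evenL (irrfl G v))
  evenR : ∀ u → R u ≡ true → oddDegree G R u ≡ false
  evenR u Ru = begin
    oddDegree G R u                                       ≡⟨ ≡.sym (xor-identityʳ (oddDegree G R u)) ⟩
    oddDegree G R u xor false                             ≡⟨ cong (oddDegree G R u xor_) (≡.sym (∧-zeroʳ (adj G v u))) ⟩
    oddDegree G R u xor (adj G v u ∧ false)               ≡⟨ cong (λ x → oddDegree G R u xor (adj G v u ∧ not x)) (≡.sym oddR) ⟩
    oddDegree G R u xor (adj G v u ∧ not (oddDegree G R v)) ≡⟨ ≡.sym (oddDegree-localComplement G v R u Ru) ⟩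
    oddDegree (localComplement G v) R u                   ≡⟨ right-even u Ru ⟩
    false                                                 ∎

∣tabulate∣-remove : ∀ {n} (W : Fin n → Bool) v → W v ≡ true →
  ∣ tabulate W ∣ ≡ suc ∣ tabulate (λ i → W i xor δ v i) ∣
∣tabulate∣-remove {suc n} W zero Wv rewrite Wv =
  cong (suc ∘ ∣_∣) (tabulate-cong (λ i → ≡.sym (xor-identityʳ (W (suc i)))))
∣tabulate∣-remove {suc n} W (suc v) Wv with W zero
... | true  = cong suc (∣tabulate∣-remove (W ∘ suc) v Wv)
... | false = ∣tabulate∣-remove (W ∘ suc) v Wv

gallai-bounded : ∀ {n} k (G : Graph n) (W : Fin n → Bool) → ∣ tabulate W ∣ ≡ k → EvenPartition G W
gallai-bounded k G W |W|≡k with any? (λ v → (W v ≟ᵇ true) ×-dec (oddDegree G W v ≟ᵇ true))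
... | no noOdd = allEven G W (λ u Wu → ¬-not (λ odd → noOdd (u , Wu , odd)))
... | yes (v , Wv , odd) with k | trans (≡.sym (∣tabulate∣-remove W v Wv)) |W|≡k
...   | suc k | |W′|≡1+k = choose (oddDegree G L v) (oddDegree G R v) refl refl oddL⊕R
  where
  W′ : _ → Bool
  W′ i = W i xor δ v i
  P = gallai-bounded k (localComplement G v) W′ (suc-injective |W′|≡1+k)
  open EvenPartition P renaming (left to L; right to R)
  oddL⊕R : oddDegree G L v xor oddDegree G R v ≡ true
  oddL⊕R = begin
    oddDegree G L v xor oddDegree G R v      ≡⟨ ≡.sym (oddDegree-xor G L R v) ⟩
    parity (λ i → (L i xor R i) ∧ adj G v i)  ≡⟨ parity-cong (λ i → cong (_∧ adj G v i) (≡.sym (splits i))) ⟩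
    oddDegree G W′ v                          ≡⟨ oddDegree-xor G W (δ v) v ⟩
    oddDegree G W v xor oddDegree G (δ v) v   ≡⟨ cong₂ _xor_ odd (trans (oddDegree-δ G v v) (irrfl G v)) ⟩
    true                                      ∎
    where open ≡-Reasoning
  choose : ∀ x y → oddDegree G L v ≡ x → oddDegree G R v ≡ y → x xor y ≡ true → EvenPartition G W
  choose false true evenL oddR _ = addVertex G W v Wv P evenL oddR
  choose true false oddL evenR _ = addVertex G W v Wv (swapSides P) evenR oddL

gallai : ∀ {n} (G : Graph n) (W : Fin n → Bool) → EvenPartition G W
gallai G W = gallai-bounded _ G W refl

∣tabulate∣-xor : ∀ {n} (f g : Fin n → Bool) → (∀ i → f i ∧ g i ≡ false) →
  ∣ tabulate (λ i → f i xor g i) ∣ ≡ ∣ tabulate f ∣ + ∣ tabulate g ∣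
∣tabulate∣-xor {zero} f g _ = refl
∣tabulate∣-xor {suc n} f g disj with f zero | g zero | disj zero | ∣tabulate∣-xor (f ∘ suc) (g ∘ suc) (disj ∘ suc)
... | true  | false | _ | ih = cong suc ih
... | false | true  | _ | ih = trans (cong suc ih) (≡.sym (+-suc _ _))
... | false | false | _ | ih = ih

∣tabulate-true∣ : ∀ {n} → ∣ tabulate {n = n} (λ _ → true) ∣ ≡ n
∣tabulate-true∣ {zero} = refl
∣tabulate-true∣ {suc n} = cong suc ∣tabulate-true∣

∣tabulate∣%2 : ∀ {n} (f : Fin n → Bool) → ∣ tabulate f ∣ % 2 ≡ (if parity f then 1 else 0)
∣tabulate∣%2 {zero} f = refl
∣tabulate∣%2 {suc n} f with f zero
... | false = ∣tabulate∣%2 (f ∘ suc)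
... | true  = begin
  (1 + ∣ tabulate (f ∘ suc) ∣) % 2       ≡⟨ %-distribˡ-+ 1 ∣ tabulate (f ∘ suc) ∣ 2 ⟩
  (1 + ∣ tabulate (f ∘ suc) ∣ % 2) % 2   ≡⟨ cong (λ r → (1 + r) % 2) (∣tabulate∣%2 (f ∘ suc)) ⟩
  (1 + (if parity (f ∘ suc) then 1 else 0)) % 2 ≡⟨ flip (parity (f ∘ suc)) ⟩
  (if not (parity (f ∘ suc)) then 1 else 0) ∎
  where
  open ≡-Reasoning
  flip : ∀ b → (1 + (if b then 1 else 0)) % 2 ≡ (if not b then 1 else 0)
  flip false = refl
  flip true  = refl

tabulate-∩ : ∀ {n} (f g : Fin n → Bool) → tabulate f ∩ tabulate g ≡ tabulate (λ i → f i ∧ g i)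
tabulate-∩ {zero} f g = refl
tabulate-∩ {suc n} f g = cong (f zero ∧ g zero ∷_) (tabulate-∩ (f ∘ suc) (g ∘ suc))

even⇒Modular2 : ∀ {n} (G : Graph n) (A : Fin n → Bool) →
  (∀ u → A u ≡ true → oddDegree G A u ≡ false) → Modular 2 G (tabulate A)
even⇒Modular2 G A even u v u∈A v∈A = trans (deg%2≡0 u u∈A) (≡.sym (deg%2≡0 v v∈A))
  where
  open ≡-Reasoning
  deg%2≡0 : ∀ u → u ∈ tabulate A → deg G (tabulate A) u % 2 ≡ 0
  deg%2≡0 u u∈A = begin
    deg G (tabulate A) u % 2                          ≡⟨ cong (λ S → ∣ S ∣ % 2) (tabulate-∩ A (adj G u)) ⟩
    ∣ tabulate (λ i → A i ∧ adj G u i) ∣ % 2          ≡⟨ ∣tabulate∣%2 (λ i → A i ∧ adj G u i) ⟩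
    (if oddDegree G A u then 1 else 0)                ≡⟨ cong (if_then 1 else 0) (even u Au) ⟩
    0                                                 ∎
    where
    Au : A u ≡ true
    Au = trans (≡.sym (lookup∘tabulate A u)) ([]=⇒lookup u∈A)

halfModular2 : ∀ {n} (G : Graph n) → ∃ λ S → Modular 2 G S × n ≤ 2 * ∣ S ∣
halfModular2 {n} G = fromLargerSide (gallai G (λ _ → true))
  where
  fromLeft : (Q : EvenPartition G (λ _ → true)) →
    ∣ tabulate (EvenPartition.right Q) ∣ ≤ ∣ tabulate (EvenPartition.left Q) ∣ → ∃ λ S → Modular 2 G S × n ≤ 2 * ∣ S ∣
  fromLeft Q r≤l = tabulate L , even⇒Modular2 G L left-even , (begin
    n                                 ≡⟨ ≡.sym (∣tabulate-true∣ {n}) ⟩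
    ∣ tabulate {n = n} (λ _ → true) ∣ ≡⟨ cong ∣_∣ (tabulate-cong splits) ⟩
    ∣ tabulate (λ i → L i xor R i) ∣  ≡⟨ ∣tabulate∣-xor L R disjoint ⟩
    ∣ tabulate L ∣ + ∣ tabulate R ∣   ≤⟨ +-monoʳ-≤ ∣ tabulate L ∣ r≤l ⟩
    ∣ tabulate L ∣ + ∣ tabulate L ∣   ≡⟨ cong (∣ tabulate L ∣ +_) (≡.sym (+-identityʳ ∣ tabulate L ∣)) ⟩
    2 * ∣ tabulate L ∣                ∎)
    where
    open ≤-Reasoning
    open EvenPartition Q renaming (left to L; right to R)
  fromLargerSide : EvenPartition G (λ _ → true) → ∃ λ S → Modular 2 G S × n ≤ 2 * ∣ S ∣
  fromLargerSide P with ≤-total ∣ tabulate (EvenPartition.right P) ∣ ∣ tabulate (EvenPartition.left P) ∣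
  ... | inj₁ r≤l = fromLeft P r≤l
  ... | inj₂ l≤r = fromLeft (swapSides P) l≤r

Modular-∣ : ∀ {n q q′} .{{_ : NonZero q}} .{{_ : NonZero q′}} (G : Graph n) (S : Subset n) →
  q ∣ q′ → Modular q′ G S → Modular q G S
Modular-∣ {q = q} {q′} G S q∣q′ mod u v u∈S v∈S = begin
  deg G S u % q         ≡⟨ ≡.sym (m∣n⇒o%n%m≡o%m q q′ (deg G S u) q∣q′) ⟩
  deg G S u % q′ % q    ≡⟨ cong (_% q) (mod u v u∈S v∈S) ⟩
  deg G S v % q′ % q    ≡⟨ m∣n⇒o%n%m≡o%m q q′ (deg G S v) q∣q′ ⟩
  deg G S v % q         ∎
  where open ≡-Reasoning

deg<∣S∣ : ∀ {n} (G : Graph n) (S : Subset n) u → u ∈ S → deg G S u < ∣ S ∣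
deg<∣S∣ G S u u∈S = p⊂q⇒∣p∣<∣q∣ (p∩q⊆p S (N G u) , u , u∈S , u∉S∩N[u])
  where
  u∉S∩N[u] : u ∉ S ∩ N G u
  u∉S∩N[u] u∈S∩N[u] with () ← trans (≡.sym (irrfl G u))
    (trans (≡.sym (lookup∘tabulate (adj G u) u)) ([]=⇒lookup (proj₂ (x∈p∩q⁻ S (N G u) u∈S∩N[u]))))

Modular⇒Regular : ∀ {n} q .{{_ : NonZero q}} (G : Graph n) (S : Subset n) → Modular q G S → ∣ S ∣ ≤ q → Regular G S
Modular⇒Regular q G S mod ∣S∣≤q with nonempty? S
... | no empty = 0 , λ v v∈S → ⊥-elim (empty (v , v∈S))
... | yes (u , u∈S) = deg G S u , λ v v∈S → begin
  deg G S v       ≡⟨ ≡.sym (deg%q v v∈S) ⟩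
  deg G S v % q   ≡⟨ mod v u v∈S u∈S ⟩
  deg G S u % q   ≡⟨ deg%q u u∈S ⟩
  deg G S u       ∎
  where
  open ≡-Reasoning
  deg%q : ∀ w → w ∈ S → deg G S w % q ≡ deg G S w
  deg%q w w∈S = m<n⇒m%n≡m (<-≤-trans (deg<∣S∣ G S w w∈S) ∣S∣≤q)

record Refinement (i j b : ℕ) : Set where
  constructor refinement
  field
    refine : ∀ {n} (G : Graph n) (m : ℕ) → 1 ≤ m → (S : Subset n) →
      Modular (2 ^ i) {{m^n≢0 2 i}} G S → b * m ≤ ∣ S ∣ →
      ∃ λ S′ → S′ ⊆ S × Modular (2 ^ j) {{m^n≢0 2 j}} G S′ × ∣ S′ ∣ ≡ m

Refinement-mono : ∀ {i j b b′} → b ≤ b′ → Refinement i j b → Refinement i j b′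
Refinement-mono b≤b′ (refinement refine) = refinement λ G m 1≤m S mod b′m≤∣S∣ →
  refine G m 1≤m S mod (≤-trans (*-monoˡ-≤ m b≤b′) b′m≤∣S∣)

Refinement-pred : ∀ {i j b} → Refinement i (suc j) b → Refinement i j b
Refinement-pred {j = j} (refinement refine) = refinement λ G m 1≤m S mod bm≤∣S∣ →
  let S′ , S′⊆S , mod′ , ∣S′∣≡m = refine G m 1≤m S mod bm≤∣S∣
  in S′ , S′⊆S , Modular-∣ {{m^n≢0 2 j}} {{m^n≢0 2 (suc j)}} G S′ (n∣m*n 2) mod′ , ∣S′∣≡m

Refinement-trans : ∀ {i j k b c} → 1 ≤ c → Refinement i j b → Refinement j k c → Refinement i k (b * c)
Refinement-trans {b = b} {c} 1≤c (refinement refine₁) (refinement refine₂) = refinement λ G m 1≤m S mod bcm≤∣S∣ →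
  let S₂ , S₂⊆S , mod₂ , ∣S₂∣≡cm =
        refine₁ G (c * m) (*-mono-≤ 1≤c 1≤m) S mod (subst (_≤ ∣ S ∣) (*-assoc b c m) bcm≤∣S∣)
      S₃ , S₃⊆S₂ , mod₃ , ∣S₃∣≡m = refine₂ G m 1≤m S₂ mod₂ (≤-reflexive (≡.sym ∣S₂∣≡cm))
  in S₃ , ⊆-trans S₃⊆S₂ S₂⊆S , mod₃ , ∣S₃∣≡m

m+n≡o⇒m≤o : ∀ {m o} n → m + n ≡ o → m ≤ o
m+n≡o⇒m≤o {m} n refl = m≤m+n m n

n<2^n : ∀ n → n < 2 ^ n
n<2^n zero = s≤s z≤n
n<2^n (suc n) = +-mono-≤ (m^n>0 2 n) (≤-trans (n<2^n n) (m≤m+n (2 ^ n) 0))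

n≤2^n : ∀ n → n ≤ 2 ^ n
n≤2^n n = <⇒≤ (n<2^n n)

C*[2^j]^a≤2^[[C+a]*j] : ∀ C a j → 1 ≤ j → C * (2 ^ j) ^ a ≤ 2 ^ ((C + a) * j)
C*[2^j]^a≤2^[[C+a]*j] C a (suc i) _ = begin
  C * (2 ^ suc i) ^ a        ≤⟨ *-mono-≤ (n≤2^n C) (≤-reflexive (^-*-assoc 2 (suc i) a)) ⟩
  2 ^ C * 2 ^ (suc i * a)    ≡⟨ ≡.sym (^-distribˡ-+-* 2 C (suc i * a)) ⟩
  2 ^ (C + suc i * a)        ≤⟨ ^-monoʳ-≤ 2 (m+n≡o⇒m≤o (C * i) (expand C a i)) ⟩
  2 ^ ((C + a) * suc i)      ∎
  where
  open ≤-Reasoning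
  expand : ∀ C a i → (C + suc i * a) + C * i ≡ (C + a) * suc i
  expand = solve-∀

refinementTower : ∀ {C a C₀} → 1 ≤ C → Refinement 1 2 C₀ →
  (∀ j → 2 ≤ j → Refinement j (suc j) (C * (2 ^ j) ^ a)) →
  ∀ k → Refinement 1 (2 + k) (2 ^ ((C₀ + C + a) * (suc k + 1) ^ 2))
refinementTower {C} {a} {C₀} 1≤C first next zero =
  Refinement-mono (≤-trans (n≤2^n C₀) (^-monoʳ-≤ 2 (m+n≡o⇒m≤o {C₀} _ (expand C₀ C a)))) first
  where
  expand : ∀ C₀ C a → C₀ + (C + a + 3 * (C₀ + C + a)) ≡ (C₀ + C + a) * 4
  expand = solve-∀
refinementTower {C} {a} {C₀} 1≤C first next (suc k) =
  Refinement-mono bound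
    (Refinement-trans (*-mono-≤ 1≤C (m^n>0 (2 ^ (2 + k)) {{m^n≢0 2 (2 + k)}} a))
      (refinementTower 1≤C first next k) (next (2 + k) (s≤s (s≤s z≤n))))
  where
  open ≤-Reasoning
  c = C₀ + C + a
  e = c * (suc k + 1) ^ 2
  expand : ∀ c k → (c * ((suc k + 1) * ((suc k + 1) * 1)) + c * (2 + k)) + c * (3 + k)
                   ≡ c * ((suc (suc k) + 1) * ((suc (suc k) + 1) * 1))
  expand = solve-∀
  bound : 2 ^ e * (C * (2 ^ (2 + k)) ^ a) ≤ 2 ^ (c * (suc (suc k) + 1) ^ 2)
  bound = begin
    2 ^ e * (C * (2 ^ (2 + k)) ^ a)   ≤⟨ *-monoʳ-≤ (2 ^ e) (C*[2^j]^a≤2^[[C+a]*j] C a (2 + k) (s≤s z≤n)) ⟩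
    2 ^ e * 2 ^ ((C + a) * (2 + k))   ≡⟨ ≡.sym (^-distribˡ-+-* 2 e ((C + a) * (2 + k))) ⟩
    2 ^ (e + (C + a) * (2 + k))       ≤⟨ ^-monoʳ-≤ 2 (+-monoʳ-≤ e (*-monoˡ-≤ (2 + k) (+-monoˡ-≤ a (m≤n+m C C₀)))) ⟩
    2 ^ (e + c * (2 + k))             ≤⟨ ^-monoʳ-≤ 2 (m+n≡o⇒m≤o (c * (3 + k)) (expand c k)) ⟩
    2 ^ (c * (suc (suc k) + 1) ^ 2)   ∎

modularWitness : ∀ {j b} → Refinement 1 j b → ∀ {n} → 2 * (b * 2 ^ j) ≤ n → (G : Graph n) →
  ∃ λ S → Modular (2 ^ j) {{m^n≢0 2 j}} G S × ∣ S ∣ ≡ 2 ^ j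
modularWitness {j} (refinement refine) 2b2ʲ≤n G =
  let S , mod , n≤2∣S∣ = halfModular2 G
      S′ , _ , mod′ , ∣S′∣≡2ʲ = refine G (2 ^ j) (m^n>0 2 j) S mod (*-cancelˡ-≤ 2 (≤-trans 2b2ʲ≤n n≤2∣S∣))
  in S′ , mod′ , ∣S′∣≡2ʲ

DyadicWitnesses : ℕ → Set
DyadicWitnesses A = ∀ r → 1 ≤ r → ∀ {n} → 2 ^ (A * ((r + 1) ^ 2)) ≤ n → (G : Graph n) →
  ∃ λ (S : Subset n) → Modular (2 ^ r) {{m^n≢0 2 r}} G S × ∣ S ∣ ≡ 2 ^ r

dyadicWitnesses : ∀ {C a C₀} → 1 ≤ C → Refinement 1 2 C₀ →
  (∀ j → 2 ≤ j → Refinement j (suc j) (C * (2 ^ j) ^ a)) → DyadicWitnesses (suc (C₀ + C + a))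
dyadicWitnesses {C} {a} {C₀} 1≤C first next (suc k) _ n≥ =
  modularWitness (Refinement-pred (refinementTower 1≤C first next k)) (≤-trans size n≥)
  where
  open ≤-Reasoning
  c = C₀ + C + a
  r = suc k
  x = c * (r + 1) ^ 2
  expand : ∀ c r → suc (c * ((r + 1) * ((r + 1) * 1)) + r) + r * (r + 1)
                   ≡ (r + 1) * ((r + 1) * 1) + c * ((r + 1) * ((r + 1) * 1))
  expand = solve-∀
  size : 2 * (2 ^ x * 2 ^ r) ≤ 2 ^ (suc c * (r + 1) ^ 2)
  size = begin
    2 * (2 ^ x * 2 ^ r)      ≡⟨ cong (2 *_) (≡.sym (^-distribˡ-+-* 2 x r)) ⟩
    2 ^ suc (x + r)          ≤⟨ ^-monoʳ-≤ 2 (m+n≡o⇒m≤o (r * (r + 1)) (expand c r)) ⟩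
    2 ^ (suc c * (r + 1) ^ 2) ∎

cube≤2^ : ∀ {r} → 12 ≤ r → (r + 2) ^ 3 ≤ 2 ^ r
cube≤2^ 12≤r with m≤n⇒∃[o]m+o≡n 12≤r
... | t , refl = shifted t
  where
  expand : ∀ s → (12 + suc s + 2) * ((12 + suc s + 2) * ((12 + suc s + 2) * 1)) + (s * s * s + 39 * (s * s) + 501 * s + 2113)
               ≡ 2 * ((12 + s + 2) * ((12 + s + 2) * ((12 + s + 2) * 1)))
  expand = solve-∀
  shifted : ∀ s → (12 + s + 2) ^ 3 ≤ 2 ^ (12 + s)
  shifted zero = ≤ᵇ⇒≤ _ _ _
  shifted (suc s) = ≤-trans (m+n≡o⇒m≤o _ (expand s)) (*-monoʳ-≤ 2 (shifted s))

quadratic≤2^ : ∀ c → ∃ λ R → ∀ r → R ≤ r → c * (r + 2) ^ 2 ≤ 2 ^ r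
quadratic≤2^ c = c + 12 , λ r c+12≤r → begin
  c * (r + 2) ^ 2         ≤⟨ *-monoˡ-≤ ((r + 2) ^ 2) (≤-trans (m≤m+n c 12) (≤-trans c+12≤r (m≤m+n r 2))) ⟩
  (r + 2) * (r + 2) ^ 2   ≤⟨ cube≤2^ (≤-trans (m≤n+m 12 c) c+12≤r) ⟩
  2 ^ r                   ∎
  where open ≤-Reasoning

boundary : ∀ {p} {P : ℕ → Set p} → Decidable P → ∀ {r} k → P r → ¬ P (r + k) →
  ∃ λ s → r ≤ s × P s × ¬ P (suc s)
boundary {P = P} P? {r} zero Pr ¬Pr+0 = ⊥-elim (¬Pr+0 (subst P (≡.sym (+-identityʳ r)) Pr))
boundary {P = P} P? {r} (suc k) Pr ¬Pr+1+k with P? (suc r)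
... | no ¬P1+r = r , ≤-refl , Pr , ¬P1+r
... | yes P1+r =
  let s , 1+r≤s , Ps , ¬P1+s = boundary P? k P1+r (subst (¬_ ∘ P) (+-suc r k) ¬Pr+1+k)
  in s , ≤-trans (n≤1+n r) 1+r≤s , Ps , ¬P1+s

r<2^[[1+c]*[r+1]²] : ∀ c r → r < 2 ^ (suc c * (r + 1) ^ 2)
r<2^[[1+c]*[r+1]²] c r = <-≤-trans (n<2^n r) (^-monoʳ-≤ 2 (m+n≡o⇒m≤o {r} _ (expand c r)))
  where
  expand : ∀ c r → r + (r * r + r + 1 + c * ((r + 1) * ((r + 1) * 1)))
                   ≡ (r + 1) * ((r + 1) * 1) + c * ((r + 1) * ((r + 1) * 1))
  expand = solve-∀

regularSuperlogarithmic : ∀ c → DyadicWitnesses (suc c) →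
  ∀ K → ∃ λ N₀ → ∀ {n} → N₀ ≤ n → (G : Graph n) → ∃ λ S → Regular G S × n ^ K ≤ 2 ^ ∣ S ∣
regularSuperlogarithmic c witnesses K =
  let R , growth = quadratic≤2^ (suc c * K) in f (suc R) , λ {n} → regular R growth
  where
  f : ℕ → ℕ
  f r = 2 ^ (suc c * (r + 1) ^ 2)
  regular : ∀ R → (∀ r → R ≤ r → suc c * K * (r + 2) ^ 2 ≤ 2 ^ r) →
    ∀ {n} → f (suc R) ≤ n → (G : Graph n) → ∃ λ S → Regular G S × n ^ K ≤ 2 ^ ∣ S ∣
  regular R growth {n} N₀≤n G =
    let n<f[1+R+n] = ≤-<-trans (m≤n+m n (suc R)) (r<2^[[1+c]*[r+1]²] c (suc R + n))
        r , 1+R≤r , fr≤n , fr+1≰n = boundary (λ r → f r ≤? n) n N₀≤n (<⇒≱ n<f[1+R+n])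
        S , mod , ∣S∣≡2ʳ = witnesses r (≤-trans (s≤s z≤n) 1+R≤r) fr≤n G
    in S , Modular⇒Regular (2 ^ r) {{m^n≢0 2 r}} G S mod (≤-reflexive ∣S∣≡2ʳ) , (begin
      n ^ K                               ≤⟨ ^-monoˡ-≤ K (<⇒≤ (≰⇒> fr+1≰n)) ⟩
      f (suc r) ^ K                       ≡⟨ ^-*-assoc 2 (suc c * (suc r + 1) ^ 2) K ⟩
      2 ^ (suc c * (suc r + 1) ^ 2 * K)   ≡⟨ cong (2 ^_) (reorder c K r) ⟩
      2 ^ (suc c * K * (r + 2) ^ 2)       ≤⟨ ^-monoʳ-≤ 2 (growth r (≤-trans (n≤1+n R) 1+R≤r)) ⟩
      2 ^ 2 ^ r                           ≡⟨ cong (2 ^_) (≡.sym ∣S∣≡2ʳ) ⟩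
      2 ^ ∣ S ∣                           ∎)
    where
    open ≤-Reasoning
    reorder : ∀ c K r → suc c * ((suc r + 1) * ((suc r + 1) * 1)) * K ≡ suc c * K * ((r + 2) * ((r + 2) * 1))
    reorder = solve-∀

mainTheorem1 :
    (C a C₀ : ℕ) → 1 ≤ C → 1 ≤ a → 1 ≤ C₀ →
    -- hypothesis (1)
    (∀ {n} (G : Graph n) (m : ℕ) → 1 ≤ m → (S : Subset n) →
      Modular 2 G S → C₀ * m ≤ ∣ S ∣ →
      ∃ λ S' → S' ⊆ S × Modular 4 G S' × ∣ S' ∣ ≡ m) →
    -- hypothesis (2), for q = 2 ^ j ≥ 4
    (∀ {n} (G : Graph n) (m : ℕ) → 1 ≤ m → (j : ℕ) → 2 ≤ j → (S : Subset n) →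
      Modular (2 ^ j) {{m^n≢0 2 j}} G S → C * (2 ^ j) ^ a * m ≤ ∣ S ∣ →
      ∃ λ S' → S' ⊆ S × Modular (2 ^ suc j) {{m^n≢0 2 (suc j)}} G S' × ∣ S' ∣ ≡ m) →
    -- conclusion: ∃ A, ∀ r ≥ 1, M(2^r, 2^r) ≤ 2^(A(r+1)^2)
    (∃ λ (A : ℕ) → ∀ (r : ℕ) → 1 ≤ r → ∀ {n} → 2 ^ (A * ((r + 1) ^ 2)) ≤ n →
      (G : Graph n) → ∃ λ (S : Subset n) → Modular (2 ^ r) {{m^n≢0 2 r}} G S × ∣ S ∣ ≡ 2 ^ r)
    ×
    -- consequence: F(n) / log n → ∞, i.e. ∀ K ∃ N ∀ n ≥ N, F(n) ≥ K log₂ n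
    (∀ (K : ℕ) → ∃ λ (N₀ : ℕ) → ∀ {n} → N₀ ≤ n → (G : Graph n) →
      ∃ λ (S : Subset n) → Regular G S × n ^ K ≤ 2 ^ ∣ S ∣)
-- The bounds hold for every a and C₀.
mainTheorem1 C a C₀ 1≤C _ _ refine₁₂ refineⱼ =
  (suc c , witnesses) , regularSuperlogarithmic c witnesses
  where
  c = C₀ + C + a
  witnesses : DyadicWitnesses (suc c)
  witnesses = dyadicWitnesses {C} {a} {C₀} 1≤C (refinement refine₁₂)
    (λ j 2≤j → refinement λ G m 1≤m → refineⱼ G m 1≤m j 2≤j)
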